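{- Let $\mathcal R$ be a polarized rewrite system such that $\longrightarrow_{ - }$ and $\longrightarrow_{+}$ commute. If $\pi$ is a proof-term of $\Gamma \vdash_{\mathcal R} A$ and $A' \longrightarrow_{+} A$, then $\pi$ is also a proof-term of $\Gamma \vdash_{\mathcal R} A'$.
   Context: Propositions are built from atomic propositions (propositional symbols) and the constant $\bot$ using the binary connectives $\Rightarrow$, $\wedge$, $\vee$; $\neg A$ abbreviates $A \Rightarrow \bot$. A rewrite rule is a pair $P \longrightarrow A$ with $P$ an atomic proposition and $A$ an arbitrary proposition. A polarized rewrite system $\mathcal R = \langle \mathcal R_{ - }, \mathcal R_{+}\rangle$ is a pair of sets of rewrite rules; rules of $\mathcal R_{ - }$ are called negative, those of $\mathcal R_{+}$ positive. The one-step relations $\longrightarrow^1_{ - }$, $\longrightarrow^1_{+}$ are the least relations on propositions such that: $P \longrightarrow^1_{ - } A$ for every negative rule $P \longrightarrow A$; $P \longrightarrow^1_{+} A$ for every positive rule $P\longrightarrow A$; $A \Rightarrow B \longrightarrow^1_{ - } A' \Rightarrow B$ if $A \longrightarrow^1_{+} A'$, and $A \Rightarrow B \longrightarrow^1_{ - } A \Rightarrow B'$ if $B \longrightarrow^1_{ - } B'$; $A \Rightarrow B \longrightarrow^1_{+} A' \Rightarrow B$ if $A \longrightarrow^1_{ - } A'$, and $A \Rightarrow B \longrightarrow^1_{+} A \Rightarrow B'$ if $B \longrightarrow^1_{+} B'$; for $\circ \in \{\wedge, \vee\}$ and $s \in \{ -,+\}$, $A \circ B \longrightarrow^1_{s}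 A' \circ B$ if $A \longrightarrow^1_{s} A'$, and $A \circ B \longrightarrow^1_{s} A \circ B'$ if $B \longrightarrow^1_{s} B'$. The relations $\longrightarrow_{ - }$, $\longrightarrow_{+}$ are the reflexive-transitive closures of $\longrightarrow^1_{ - }$, $\longrightarrow^1_{+}$; $B \longleftarrow_{s} A$ means $A \longrightarrow_{s} B$. The relations $\longrightarrow_{ - }$ and $\longrightarrow_{+}$ commute if whenever $A \longleftarrow_{ - } B \longrightarrow_{+} C$ there is a proposition $D$ with $A \longrightarrow_{+} D \longleftarrow_{ - } C$. Proof-terms: $\pi ::= \alpha \mid \lambda\alpha\,\pi \mid (\pi_1\,\pi_2) \mid \langle \pi_1,\pi_2\rangle \mid \mathit{fst}(\pi) \mid \mathit{snd}(\pi) \mid i(\pi) \mid j(\pi) \mid \delta(\pi_1, \alpha\pi_2, \beta\pi_3) \mid \delta_\bot(\pi)$, with $\alpha,\beta$ proof variables ($\lambda\alpha$ binds $\alpha$; in $\delta(\pi_1,\alpha\pi_2,\beta\pi_3)$, $\alpha$ is bound in $\pi_2$ and $\beta$ in $\pi_3$). A context $\Gamma$ is a finite set of declarations $\alpha : B$ of distinct proof variables. "$\pi$ is a proof-term of $\Gamma \vdash_{\mathcal R} A$" (polarized natural deduction modulo $\mathcal R$) is defined inductively: (axiom) $\alpha$ is a proof-term of $\Gamma \vdash_{\mathcal R} A$ if $\alpha:B \in \Gamma$ and $B \longrightarrow_{ - } C \longleftarrow_{+} A$ for some $C$; ($\Rightarrow$-intro) if $\pi$ is a proof-term of $\Gamma,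 \alpha:A \vdash_{\mathcal R} B$ and $C \longrightarrow_{+} (A \Rightarrow B)$ then $\lambda\alpha\,\pi$ is one of $\Gamma \vdash_{\mathcal R} C$; ($\Rightarrow$-elim) if $\pi_1$ is one of $\Gamma\vdash_{\mathcal R} C$ with $C \longrightarrow_{ - } (A \Rightarrow B)$ and $\pi_2$ one of $\Gamma \vdash_{\mathcal R} A$, then $(\pi_1\,\pi_2)$ is one of $\Gamma \vdash_{\mathcal R} B$; ($\wedge$-intro) if $\pi_1$ is one of $\Gamma \vdash_{\mathcal R} A$, $\pi_2$ one of $\Gamma\vdash_{\mathcal R} B$ and $C \longrightarrow_{+} (A\wedge B)$, then $\langle\pi_1,\pi_2\rangle$ is one of $\Gamma \vdash_{\mathcal R} C$; ($\wedge$-elim) if $\pi$ is one of $\Gamma \vdash_{\mathcal R} C$ and $C \longrightarrow_{ - } (A \wedge B)$ then $\mathit{fst}(\pi)$ is one of $\Gamma\vdash_{\mathcal R} A$ and $\mathit{snd}(\pi)$ one of $\Gamma \vdash_{\mathcal R} B$; ($\vee$-intro) if $\pi$ is one of $\Gamma\vdash_{\mathcal R} A$ (resp. $\Gamma \vdash_{\mathcal R} B$) and $C \longrightarrow_{+} (A \vee B)$ then $i(\pi)$ (resp. $j(\pi)$) is one of $\Gamma \vdash_{\mathcal R} C$; ($\vee$-elim) if $\pi_1$ is one of $\Gamma\vdash_{\mathcal R} D$ with $D \longrightarrow_{ - } (A\vee B)$, $\pi_2$ one of $\Gamma,\alpha:A \vdash_{\mathcal R} C$ and $\pi_3$ one of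 $\Gamma,\beta:B\vdash_{\mathcal R} C$, then $\delta(\pi_1,\alpha\pi_2,\beta\pi_3)$ is one of $\Gamma \vdash_{\mathcal R} C$; ($\bot$-elim) if $\pi$ is one of $\Gamma \vdash_{\mathcal R} B$ with $B \longrightarrow_{ - } \bot$ then $\delta_\bot(\pi)$ is one of $\Gamma \vdash_{\mathcal R} A$ for every $A$. -}

module Defs where

open import Data.Nat using (ℕ)
open import Data.Product using (_×_; _,_; ∃-syntax; proj₁)
open import Data.List using (List; []; _∷_; map)
open import Data.List.Membership.Propositional using (_∈_; _∉_)
open import Data.List.Relation.Unary.Unique.Propositional using (Unique)
open import Relation.Binary.Construct.Closure.ReflexiveTransitive using (Star)

data Prop (Atom : Set) : Set where
  atom : Atom → Prop Atom
  ⊥'   : Prop Atom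
  _⇒_  : Prop Atom → Prop Atom → Prop Atom
  _∧_  : Prop Atom → Prop Atom → Prop Atom
  _∨_  : Prop Atom → Prop Atom → Prop Atom

infixr 5 _⇒_
infixr 6 _∨_
infixr 7 _∧_

¬' : {Atom : Set} → Prop Atom → Prop Atom
¬' A = A ⇒ ⊥'

RuleSet : Set → Set₁
RuleSet Atom = Atom → Prop Atom → Set

record Polarized (Atom : Set) : Set₁ where
  constructor ⟨_,_⟩
  field
    neg : RuleSet Atom
    pos : RuleSet Atom
open Polarized public

module _ {Atom : Set} (R : Polarized Atom) where
  data _⟶¹₋_ : Prop Atom → Prop Atom → Set
  data _⟶¹₊_ : Prop Atom → Prop Atom → Set

  data _⟶¹₋_ where
    rule  : ∀ {P A} → neg R P A → atom P ⟶¹₋ A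
    ⇒l    : ∀ {A A' B} → A ⟶¹₊ A' → (A ⇒ B) ⟶¹₋ (A' ⇒ B)
    ⇒r    : ∀ {A B B'} → B ⟶¹₋ B' → (A ⇒ B) ⟶¹₋ (A ⇒ B')
    ∧l    : ∀ {A A' B} → A ⟶¹₋ A' → (A ∧ B) ⟶¹₋ (A' ∧ B)
    ∧r    : ∀ {A B B'} → B ⟶¹₋ B' → (A ∧ B) ⟶¹₋ (A ∧ B')
    ∨l    : ∀ {A A' B} → A ⟶¹₋ A' → (A ∨ B) ⟶¹₋ (A' ∨ B)
    ∨r    : ∀ {A B B'} → B ⟶¹₋ B' → (A ∨ B) ⟶¹₋ (A ∨ B')

  data _⟶¹₊_ where
    rule  : ∀ {P A} → pos R P A → atom P ⟶¹₊ A
    ⇒l    : ∀ {A A' B} → A ⟶¹₋ A' → (A ⇒ B) ⟶¹₊ (A' ⇒ B)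
    ⇒r    : ∀ {A B B'} → B ⟶¹₊ B' → (A ⇒ B) ⟶¹₊ (A ⇒ B')
    ∧l    : ∀ {A A' B} → A ⟶¹₊ A' → (A ∧ B) ⟶¹₊ (A' ∧ B)
    ∧r    : ∀ {A B B'} → B ⟶¹₊ B' → (A ∧ B) ⟶¹₊ (A ∧ B')
    ∨l    : ∀ {A A' B} → A ⟶¹₊ A' → (A ∨ B) ⟶¹₊ (A' ∨ B)
    ∨r    : ∀ {A B B'} → B ⟶¹₊ B' → (A ∨ B) ⟶¹₊ (A ∨ B')

  _⟶₋_ : Prop Atom → Prop Atom → Set
  _⟶₋_ = Star _⟶¹₋_

  _⟶₊_ : Prop Atom → Prop Atom → Set
  _⟶₊_ = Star _⟶¹₊_

  Commute : Set
  Commute = ∀ {A B C} → B ⟶₋ A → B ⟶₊ C → ∃[ D ] (A ⟶₊ D × C ⟶₋ D)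

Var : Set
Var = ℕ

data Term : Set where
  var   : Var → Term
  lam   : Var → Term → Term
  app   : Term → Term → Term
  pair  : Term → Term → Term
  fst   : Term → Term
  snd   : Term → Term
  inl   : Term → Term
  inr   : Term → Term
  case  : Term → Var → Term → Var → Term → Term
  abort : Term → Term

-- contexts: finite lists of declarations α : B; "Γ, α : A" is written (α , A) ∷ Γ
Context : Set → Set
Context Atom = List (Var × Prop Atom)

WellFormed : {Atom : Set} → Context Atom → Set
WellFormed Γ = Unique (map proj₁ Γ)

module _ {Atom : Set} (R : Polarized Atom) where
  data _⊢_∶_ : Context Atom → Term → Prop Atom → Set where
    ax     : ∀ {Γ α A B C} → (α , B) ∈ Γ → _⟶₋_ R B C → _⟶₊_ R A C →
             Γ ⊢ var α ∶ A
    ⇒I     : ∀ {Γ α π A B C} → α ∉ map proj₁ Γ → ((α , A) ∷ Γ) ⊢ π ∶ B →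
             _⟶₊_ R C (A ⇒ B) → Γ ⊢ lam α π ∶ C
    ⇒E     : ∀ {Γ π₁ π₂ A B C} → Γ ⊢ π₁ ∶ C → _⟶₋_ R C (A ⇒ B) →
             Γ ⊢ π₂ ∶ A → Γ ⊢ app π₁ π₂ ∶ B
    ∧I     : ∀ {Γ π₁ π₂ A B C} → Γ ⊢ π₁ ∶ A → Γ ⊢ π₂ ∶ B →
             _⟶₊_ R C (A ∧ B) → Γ ⊢ pair π₁ π₂ ∶ C
    ∧E₁    : ∀ {Γ π A B C} → Γ ⊢ π ∶ C → _⟶₋_ R C (A ∧ B) → Γ ⊢ fst π ∶ A
    ∧E₂    : ∀ {Γ π A B C} → Γ ⊢ π ∶ C → _⟶₋_ R C (A ∧ B) → Γ ⊢ snd π ∶ B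
    ∨I₁    : ∀ {Γ π A B C} → Γ ⊢ π ∶ A → _⟶₊_ R C (A ∨ B) → Γ ⊢ inl π ∶ C
    ∨I₂    : ∀ {Γ π A B C} → Γ ⊢ π ∶ B → _⟶₊_ R C (A ∨ B) → Γ ⊢ inr π ∶ C
    ∨E     : ∀ {Γ π₁ π₂ π₃ α β A B C D} → Γ ⊢ π₁ ∶ D → _⟶₋_ R D (A ∨ B) →
             α ∉ map proj₁ Γ → ((α , A) ∷ Γ) ⊢ π₂ ∶ C →
             β ∉ map proj₁ Γ → ((β , B) ∷ Γ) ⊢ π₃ ∶ C →
             Γ ⊢ case π₁ α π₂ β π₃ ∶ C
    ⊥E     : ∀ {Γ π A B} → Γ ⊢ π ∶ B → _⟶₋_ R B ⊥' → Γ ⊢ abort π ∶ A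

-- Induction on the derivation proves more: a proof-term of A is one of every A' with A ⟶₋ X ⟵₊ A' for
-- some X (the theorem is the case X = A). At an introduction rule, commutation closes C ⟶₊ (A ⇒ B) and
-- C ⟶₋ X to some D; as the negative reducts of A ⇒ B are the A₁ ⇒ B₁ with A ⟶₊ A₁ and B ⟶₋ B₁, the join
-- descends to the premises. For ⇒ this also replaces the hypothesis A by A₁, which commutation permits
-- just as the axiom rule absorbs a join.
module Submission where

open import Defs
open import Data.Product using (_×_; _,_; ∃-syntax; proj₁)
open import Data.List using ([]; _∷_; map)
open import Data.List.Membership.Propositional using (_∈_; _∉_)
open import Data.List.Relation.Unary.Any using (here; there)
open import Relation.Binary.Construct.Closure.ReflexiveTransitive using (ε; _◅_; _◅◅_; gmap)
open import Relation.Binary.PropositionalEquality using (_≡_; refl; cong; subst)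

module _ {Atom : Set} (R : Polarized Atom) where

  private
    _↠₋_ _↠₊_ : Prop Atom → Prop Atom → Set
    _↠₋_ = _⟶₋_ R
    _↠₊_ = _⟶₊_ R

    _⊢_⦂_ : Context Atom → Term → Prop Atom → Set
    _⊢_⦂_ = _⊢_∶_ R

  data ⇒-Reduct₋ (A B : Prop Atom) : Prop Atom → Set where
    reduct : ∀ {A₁ B₁} → A ↠₊ A₁ → B ↠₋ B₁ → ⇒-Reduct₋ A B (A₁ ⇒ B₁)

  data ∧-Reduct₋ (A B : Prop Atom) : Prop Atom → Set where
    reduct : ∀ {A₁ B₁} → A ↠₋ A₁ → B ↠₋ B₁ → ∧-Reduct₋ A B (A₁ ∧ B₁)

  data ∨-Reduct₋ (A B : Prop Atom) : Prop Atom → Set where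
    reduct : ∀ {A₁ B₁} → A ↠₋ A₁ → B ↠₋ B₁ → ∨-Reduct₋ A B (A₁ ∨ B₁)

  ⇒-↠₋-inv : ∀ {A B D} → (A ⇒ B) ↠₋ D → ⇒-Reduct₋ A B D
  ⇒-↠₋-inv ε = reduct ε ε
  ⇒-↠₋-inv (⇒l s ◅ ss) with ⇒-↠₋-inv ss
  ... | reduct p q = reduct (s ◅ p) q
  ⇒-↠₋-inv (⇒r s ◅ ss) with ⇒-↠₋-inv ss
  ... | reduct p q = reduct p (s ◅ q)

  ∧-↠₋-inv : ∀ {A B D} → (A ∧ B) ↠₋ D → ∧-Reduct₋ A B D
  ∧-↠₋-inv ε = reduct ε ε
  ∧-↠₋-inv (∧l s ◅ ss) with ∧-↠₋-inv ss
  ... | reduct p q = reduct (s ◅ p) q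
  ∧-↠₋-inv (∧r s ◅ ss) with ∧-↠₋-inv ss
  ... | reduct p q = reduct p (s ◅ q)

  ∨-↠₋-inv : ∀ {A B D} → (A ∨ B) ↠₋ D → ∨-Reduct₋ A B D
  ∨-↠₋-inv ε = reduct ε ε
  ∨-↠₋-inv (∨l s ◅ ss) with ∨-↠₋-inv ss
  ... | reduct p q = reduct (s ◅ p) q
  ∨-↠₋-inv (∨r s ◅ ss) with ∨-↠₋-inv ss
  ... | reduct p q = reduct p (s ◅ q)

  infix 4 _↠₊ᶜ_

  data _↠₊ᶜ_ : Context Atom → Context Atom → Set where
    []  : [] ↠₊ᶜ []
    _∷_ : ∀ {α B B' Γ Γ'} → B ↠₊ B' → Γ ↠₊ᶜ Γ' → (α , B) ∷ Γ ↠₊ᶜ (α , B') ∷ Γ'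

  ↠₊ᶜ-refl : ∀ Γ → Γ ↠₊ᶜ Γ
  ↠₊ᶜ-refl []      = []
  ↠₊ᶜ-refl (_ ∷ Γ) = ε ∷ ↠₊ᶜ-refl Γ

  ↠₊ᶜ-vars : ∀ {Γ Γ'} → Γ ↠₊ᶜ Γ' → map proj₁ Γ ≡ map proj₁ Γ'
  ↠₊ᶜ-vars []      = refl
  ↠₊ᶜ-vars (_ ∷ r) = cong (_ ∷_) (↠₊ᶜ-vars r)

  ↠₊ᶜ-∉ : ∀ {Γ Γ' α} → Γ ↠₊ᶜ Γ' → α ∉ map proj₁ Γ → α ∉ map proj₁ Γ'
  ↠₊ᶜ-∉ r = subst (_ ∉_) (↠₊ᶜ-vars r)

  ↠₊ᶜ-∈ : ∀ {Γ Γ' α B} → Γ ↠₊ᶜ Γ' → (α , B) ∈ Γ → ∃[ B' ] ((α , B') ∈ Γ' × B ↠₊ B')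
  ↠₊ᶜ-∈ (p ∷ _) (here refl) = _ , here refl , p
  ↠₊ᶜ-∈ (_ ∷ r) (there m) with ↠₊ᶜ-∈ r m
  ... | B' , m' , p = B' , there m' , p

  module _ (commute : Commute R) where

    ⊢-↠₊ᶜ : ∀ {Γ Γ' π A} → Γ ↠₊ᶜ Γ' → Γ ⊢ π ⦂ A → Γ' ⊢ π ⦂ A
    ⊢-↠₊ᶜ r (ax m p q) with ↠₊ᶜ-∈ r m
    ... | _ , m' , s with commute p s
    ... | _ , s' , p' = ax m' p' (q ◅◅ s')
    ⊢-↠₊ᶜ r (⇒I n d s)   = ⇒I (↠₊ᶜ-∉ r n) (⊢-↠₊ᶜ (ε ∷ r) d) s
    ⊢-↠₊ᶜ r (⇒E d s e)   = ⇒E (⊢-↠₊ᶜ r d) s (⊢-↠₊ᶜ r e)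
    ⊢-↠₊ᶜ r (∧I d e s)   = ∧I (⊢-↠₊ᶜ r d) (⊢-↠₊ᶜ r e) s
    ⊢-↠₊ᶜ r (∧E₁ d s)    = ∧E₁ (⊢-↠₊ᶜ r d) s
    ⊢-↠₊ᶜ r (∧E₂ d s)    = ∧E₂ (⊢-↠₊ᶜ r d) s
    ⊢-↠₊ᶜ r (∨I₁ d s)    = ∨I₁ (⊢-↠₊ᶜ r d) s
    ⊢-↠₊ᶜ r (∨I₂ d s)    = ∨I₂ (⊢-↠₊ᶜ r d) s
    ⊢-↠₊ᶜ r (∨E d s m e n f) =
      ∨E (⊢-↠₊ᶜ r d) s (↠₊ᶜ-∉ r m) (⊢-↠₊ᶜ (ε ∷ r) e) (↠₊ᶜ-∉ r n) (⊢-↠₊ᶜ (ε ∷ r) f)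
    ⊢-↠₊ᶜ r (⊥E d s)     = ⊥E (⊢-↠₊ᶜ r d) s

    ⊢-join : ∀ {Γ π A A' X} → Γ ⊢ π ⦂ A → A ↠₋ X → A' ↠₊ X → Γ ⊢ π ⦂ A'
    ⊢-join (ax m p q) s t with commute s q
    ... | _ , q' , s' = ax m (p ◅◅ s') (t ◅◅ q')
    ⊢-join (⇒I {Γ = Γ} n d q) s t with commute s q
    ... | _ , q' , s' with ⇒-↠₋-inv s'
    ... | reduct pa pb = ⇒I n (⊢-join (⊢-↠₊ᶜ (pa ∷ ↠₊ᶜ-refl Γ) d) pb ε) (t ◅◅ q')
    ⊢-join (∧I d e q) s t with commute s q
    ... | _ , q' , s' with ∧-↠₋-inv s'
    ... | reduct pa pb = ∧I (⊢-join d pa ε) (⊢-join e pb ε) (t ◅◅ q')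
    ⊢-join (∨I₁ d q) s t with commute s q
    ... | _ , q' , s' with ∨-↠₋-inv s'
    ... | reduct pa _ = ∨I₁ (⊢-join d pa ε) (t ◅◅ q')
    ⊢-join (∨I₂ d q) s t with commute s q
    ... | _ , q' , s' with ∨-↠₋-inv s'
    ... | reduct _ pb = ∨I₂ (⊢-join d pb ε) (t ◅◅ q')
    ⊢-join (⇒E d p e) s t = ⇒E (⊢-join d (p ◅◅ gmap _ ⇒r s) (gmap _ ⇒r t)) ε e
    ⊢-join (∧E₁ d p) s t  = ∧E₁ (⊢-join d (p ◅◅ gmap _ ∧l s) (gmap _ ∧l t)) ε
    ⊢-join (∧E₂ d p) s t  = ∧E₂ (⊢-join d (p ◅◅ gmap _ ∧r s) (gmap _ ∧r t)) ε
    ⊢-join (∨E d p m e n f) s t = ∨E d p m (⊢-join e s t) n (⊢-join f s t)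
    ⊢-join (⊥E d p) _ _   = ⊥E d p

proposition2 : {Atom : Set} (R : Polarized Atom) → Commute R →
    ∀ {Γ : Context Atom} {π : Term} {A A' : Prop Atom} →
    WellFormed Γ → _⊢_∶_ R Γ π A → _⟶₊_ R A' A → _⊢_∶_ R Γ π A'
proposition2 R commute _ d t = ⊢-join R commute d ε t
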